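{- Let $p\geq 3$ be a prime, let $k\geq 2$ be an integer, and let $Q(k)=\{b\in\mathbb{F}_p : \text{there exists } x\in\mathbb{F}_p \text{ with } x^k= b\}$ denote the set of $k$th power residues modulo $p$ (so $0\in Q(k)$). Let $n\geq 1$ be an integer and set $d:=\gcd(k,p-1)$. Suppose that $A\subseteq(\mathbb{F}_p)^n$ is a subset such that $$|A|>\Big(\frac{(p-1)(d-1)}{d}+1\Big)^n.$$ Then there exist $\mathbf{a}_1,\mathbf{a}_2\in A$ with $\mathbf{a}_1\neq\mathbf{a}_2$ such that $\mathbf{a}_1-\mathbf{a}_2\in (Q(k))^n$.
   Context: $\mathbb{F}_p$ denotes the field with $p$ elements, and $(Q(k))^n$ denotes the set of vectors in $(\mathbb{F}_p)^n$ all of whose coordinates lie in $Q(k)$. -}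

module Defs where

open import Data.Nat using (ℕ; suc; _+_; _*_; _∸_; _^_; NonZero)
open import Data.Nat.DivMod using (_%_; _/_)
open import Data.Fin using (Fin; toℕ; fromℕ<)
open import Data.Nat.DivMod using (m%n<n)
open import Data.Vec using (Vec; zipWith)
open import Data.Vec.Relation.Unary.All using (All)
open import Data.Product using (∃)
open import Relation.Binary.PropositionalEquality using (_≡_)

-- F_p is modelled as Fin p (residues 0 .. p-1) with arithmetic mod p.

_-ₚ_ : ∀ {p} .{{_ : NonZero p}} → Fin p → Fin p → Fin p
_-ₚ_ {p} a b = fromℕ< (m%n<n (toℕ a + (p ∸ toℕ b)) p)

Q : ∀ {p} .{{_ : NonZero p}} → ℕ → Fin p → Set
Q {p} k b = ∃ λ (x : Fin p) → (toℕ x ^ k) % p ≡ toℕ b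

_-ᵥ_ : ∀ {p n} .{{_ : NonZero p}} → Vec (Fin p) n → Vec (Fin p) n → Vec (Fin p) n
_-ᵥ_ = zipWith _-ₚ_

Qⁿ : ∀ {p n} .{{_ : NonZero p}} → ℕ → Vec (Fin p) n → Set
Qⁿ k v = All (Q k) v

-- The proof is the rank (polynomial) method, run on integers modulo p.
-- Rank bound: if K(x, y) = Σ_{r<R} u_r(x) v_r(y) and, on a finite set S, K is
-- diagonal modulo p with diagonal entries ≢ 0, then |S| ≤ R; otherwise a
-- homogeneous system of R equations in |S| unknowns has a non-trivial
-- solution mod p, which the diagonal matrix cannot annihilate.
-- Apply it to Gⁿ(a, b) = Π_i Π_{c ∉ Q(k)} (a_i − b_i − c) on A: Gⁿ(a, a) ≢ 0
-- since 0 ∈ Q(k), Gⁿ(a, b) ≡ 0 once a − b ∉ (Q(k))^n, and Gⁿ has rank at most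
-- (|F_p \ Q(k)| + 1)^n, being a tensor power of a polynomial of that degree.
-- Finally |F_p \ Q(k)| ≤ (p − 1)(d − 1)/d, because each fibre of x ↦ x^k has
-- at most d points: again the rank bound, now for Σ_{j<d} x^j y^(d−1−j), with
-- Fermat and Bézout giving x^k ≡ y^k ⇒ x^d ≡ y^d.
module Submission where

open import Defs using (_-ₚ_; Q; _-ᵥ_; Qⁿ)

open import Data.Nat as ℕ using (ℕ; zero; suc; NonZero)
import Data.Nat.Properties as ℕP
import Data.Nat.Divisibility as ℕD
import Data.Nat.DivMod as ℕDM
open import Data.Nat.Combinatorics using (_C_; nCk≡n!/k![n-k]!; k![n∸k]!∣n!; nCn≡1)
open import Data.Nat.GCD using (gcd; gcd-GCD; gcd[m,n]≢0; gcd[m,n]∣n; module Bézout)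
open import Data.Nat.Primality using (Prime; prime⇒nonZero; prime⇒nonTrivial; euclidsLemma)
open import Data.Fin as Fin using (Fin; zero; suc; toℕ)
import Data.Fin.Properties as FinP
import Data.Integer as ℤ
import Data.Integer.Properties as ℤP
open import Data.Integer.Tactic.RingSolver using (solve-∀)
open import Data.List as List using (List; []; _∷_; length)
import Data.List.Properties as ListP
import Data.List.Relation.Unary.All as All
import Data.List.Relation.Unary.AllPairs as AllPairs
import Data.List.Relation.Unary.Any as Any
open Any using (here; there)
open import Data.List.Relation.Unary.Unique.Propositional using (Unique)
import Data.List.Relation.Unary.Unique.Propositional.Properties as Unique
open import Data.List.Membership.Propositional using (_∈_; find; lose)
open import Data.List.Membership.Propositional.Properties
  using (∈-lookup; ∈-filter⁺; ∈-filter⁻; ∈-allFin; ∈-map⁺; ∈-map⁻)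
open import Data.Vec using (Vec; []; _∷_)
import Data.Vec.Properties as VecP
import Data.Vec.Relation.Unary.All as VecAll
open import Data.Product using (Σ; _×_; _,_; proj₁; proj₂)
open import Data.Sum using (_⊎_; inj₁; inj₂; [_,_]; [_,_]′)
open import Data.Empty using (⊥; ⊥-elim)
open import Function using (id)
open import Relation.Nullary using (¬_; Dec; yes; no; ¬?; _×-dec_)
open import Relation.Nullary.Decidable using (decidable-stable)
open import Relation.Unary using (Decidable)
open import Relation.Binary.Definitions using (DecidableEquality)
open import Relation.Binary.Bundles using (Setoid)
open import Relation.Binary.Structures using (IsEquivalence)
import Relation.Binary.Reasoning.Setoid as SetoidReasoning
open import Relation.Binary.PropositionalEquality
  using (_≡_; _≢_; refl; sym; trans; cong; cong₂; subst; module ≡-Reasoning)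

module Kernels where

  open ℤ using (ℤ; +_; 0ℤ; 1ℤ; _+_; _*_; _-_; _^_)
  open import Algebra.Properties.Semiring.Sum ℤP.+-*-semiring public
    using (sum; sum-syntax; sum-cong-≗; sum-init-last; ∑-comm; *-distribˡ-sum; *-distribʳ-sum)
  open ≡-Reasoning

  ^-by-product : ∀ x u k → x ^ (u ℕ.* k) ≡ (x ^ k) ^ u
  ^-by-product x u k = trans (cong (x ^_) (ℕP.*-comm u k)) (sym (ℤP.^-*-assoc x k u))

  sum-const : ∀ n c → ∑[ i < n ] c ≡ + n * c
  sum-const zero    c = sym (ℤP.*-zeroˡ c)
  sum-const (suc n) c = trans (cong (_+_ c) (sum-const n c)) (sym (ℤP.suc-* (+ n) c))

  sum-split : ∀ m n (f : Fin (m ℕ.+ n) → ℤ) →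
    sum f ≡ ∑[ i < m ] f (i Fin.↑ˡ n) + ∑[ j < n ] f (m Fin.↑ʳ j)
  sum-split zero    n f = sym (ℤP.+-identityˡ _)
  sum-split (suc m) n f =
    trans (cong (_+_ (f zero)) (sum-split m n (λ i → f (suc i)))) (sym (ℤP.+-assoc (f zero) _ _))

  sum-combine : ∀ m n (f : Fin (m ℕ.* n) → ℤ) →
    sum f ≡ ∑[ i < m ] ∑[ j < n ] f (Fin.combine i j)
  sum-combine zero    n f = refl
  sum-combine (suc m) n f =
    trans (sum-split n (m ℕ.* n) f)
      (cong (_+_ (∑[ j < n ] f (Fin.combine {suc m} zero j))) (sum-combine m n (λ k → f (n Fin.↑ʳ k))))

  sum-*-sum : ∀ {m n} (f : Fin m → ℤ) (g : Fin n → ℤ) →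
    sum f * sum g ≡ ∑[ i < m ] ∑[ j < n ] (f i * g j)
  sum-*-sum f g =
    trans (*-distribʳ-sum (sum g) f) (sum-cong-≗ (λ i → *-distribˡ-sum (f i) g))

  -- K has rank at most R: it factors as K x y = Σ_{r<R} left_r(x) · right_r(y).
  -- Such a kernel restricted to any finite set gives a matrix of rank ≤ R.
  record LowRank {X : Set} (K : X → X → ℤ) (R : ℕ) : Set where
    field
      left right  : Fin R → X → ℤ
      factorises  : ∀ x y → K x y ≡ ∑[ r < R ] (left r x * right r y)

  lowRank-resp : ∀ {X R} {K L : X → X → ℤ} →
    (∀ x y → K x y ≡ L x y) → LowRank K R → LowRank L R
  lowRank-resp K≡L rk = record
    { left = left ; right = right
    ; factorises = λ x y → trans (sym (K≡L x y)) (factorises x y) }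
    where open LowRank rk

  lowRank-pullback : ∀ {X Y R} {K : X → X → ℤ} (f : Y → X) →
    LowRank K R → LowRank (λ a b → K (f a) (f b)) R
  lowRank-pullback f rk = record
    { left = λ r a → left r (f a) ; right = λ r b → right r (f b)
    ; factorises = λ a b → factorises (f a) (f b) }
    where open LowRank rk

  lowRank-⊗ : ∀ {X Y R S} {K : X → X → ℤ} {L : Y → Y → ℤ} → LowRank K R → LowRank L S →
    LowRank (λ (xa yb : X × Y) → K (proj₁ xa) (proj₁ yb) * L (proj₂ xa) (proj₂ yb)) (R ℕ.* S)
  lowRank-⊗ {X} {Y} {R} {S} {K} {L} rk rl = record
    { left = λ t (x , a) → let (i , j) = Fin.remQuot S t in K.left i x * L.left j a
    ; right = λ t (y , b) → let (i , j) = Fin.remQuot S t in K.right i y * L.right j b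
    ; factorises = factorises }
    where
    module K = LowRank rk
    module L = LowRank rl
    interchange : ∀ a b c d → (a * b) * (c * d) ≡ (a * c) * (b * d)
    interchange = solve-∀
    factorises : ∀ (xa yb : X × Y) → K (proj₁ xa) (proj₁ yb) * L (proj₂ xa) (proj₂ yb) ≡
      ∑[ t < R ℕ.* S ] (let (i , j) = Fin.remQuot S t in
        (K.left i (proj₁ xa) * L.left j (proj₂ xa)) * (K.right i (proj₁ yb) * L.right j (proj₂ yb)))
    factorises (x , a) (y , b) = begin
      K x y * L a b
        ≡⟨ cong₂ _*_ (K.factorises x y) (L.factorises a b) ⟩
      ∑[ i < R ] (K.left i x * K.right i y) * ∑[ j < S ] (L.left j a * L.right j b)
        ≡⟨ sum-*-sum (λ i → K.left i x * K.right i y) (λ j → L.left j a * L.right j b) ⟩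
      ∑[ i < R ] ∑[ j < S ] ((K.left i x * K.right i y) * (L.left j a * L.right j b))
        ≡⟨ sum-cong-≗ (λ i → sum-cong-≗ (regroup i)) ⟩
      ∑[ i < R ] ∑[ j < S ] term (Fin.combine i j)
        ≡⟨ sym (sum-combine R S term) ⟩
      ∑[ t < R ℕ.* S ] term t ∎
      where
      term₂ : Fin R × Fin S → ℤ
      term₂ (i , j) = (K.left i x * L.left j a) * (K.right i y * L.right j b)
      term : Fin (R ℕ.* S) → ℤ
      term t = term₂ (Fin.remQuot S t)
      regroup : ∀ i j → (K.left i x * K.right i y) * (L.left j a * L.right j b) ≡ term (Fin.combine i j)
      regroup i j = trans (interchange (K.left i x) (K.right i y) (L.left j a) (L.right j b))
                          (cong term₂ (sym (FinP.remQuot-combine {R} {S} i j)))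

  productKernel : ∀ {X : Set} (K : X → X → ℤ) {n} → Vec X n → Vec X n → ℤ
  productKernel K []       []       = 1ℤ
  productKernel K (x ∷ a) (y ∷ b) = K x y * productKernel K a b

  lowRank-productKernel : ∀ {X R} {K : X → X → ℤ} → LowRank K R →
    ∀ n → LowRank (productKernel K {n}) (R ℕ.^ n)
  lowRank-productKernel rk zero = record
    { left = λ _ _ → 1ℤ ; right = λ _ _ → 1ℤ ; factorises = λ { [] [] → refl } }
  lowRank-productKernel {X} {K = K} rk (suc n) =
    lowRank-resp (λ { (x ∷ a) (y ∷ b) → refl })
      (lowRank-pullback uncons (lowRank-⊗ rk (lowRank-productKernel rk n)))
    where
    uncons : Vec X (suc n) → X × Vec X n
    uncons (x ∷ a) = x , a

  -- Polynomials in x whose coefficients are integer functions of y,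
  -- stored as coefficient lists starting with the constant term.
  CoeffPoly : Set
  CoeffPoly = List (ℤ → ℤ)

  evalPoly : CoeffPoly → ℤ → ℤ → ℤ
  evalPoly []       x y = 0ℤ
  evalPoly (c ∷ cs) x y = c y + x * evalPoly cs x y

  evalPoly-monomials : ∀ cs x y →
    evalPoly cs x y ≡ ∑[ r < length cs ] (x ^ toℕ r * List.lookup cs r y)
  evalPoly-monomials []       x y = refl
  evalPoly-monomials (c ∷ cs) x y = cong₂ _+_ (sym (ℤP.*-identityˡ (c y))) (begin
    x * evalPoly cs x y
      ≡⟨ cong (_*_ x) (evalPoly-monomials cs x y) ⟩
    x * ∑[ r < length cs ] (x ^ toℕ r * List.lookup cs r y)
      ≡⟨ *-distribˡ-sum x (λ r → x ^ toℕ r * List.lookup cs r y) ⟩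
    ∑[ r < length cs ] (x * (x ^ toℕ r * List.lookup cs r y))
      ≡⟨ sum-cong-≗ (λ r → sym (ℤP.*-assoc x (x ^ toℕ r) (List.lookup cs r y))) ⟩
    ∑[ r < length cs ] (x ^ suc (toℕ r) * List.lookup cs r y) ∎)

  lowRank-poly : ∀ cs → LowRank (evalPoly cs) (length cs)
  lowRank-poly cs = record
    { left = λ r x → x ^ toℕ r ; right = λ r y → List.lookup cs r y
    ; factorises = evalPoly-monomials cs }

  -- mulLinear e c cs is the coefficient list of c(y) + (x − e(y)) · cs; it is
  -- the multiplication by the linear factor x − e(y) when c = 0.
  mulLinear : (ℤ → ℤ) → (ℤ → ℤ) → CoeffPoly → CoeffPoly
  mulLinear e c []        = c ∷ []
  mulLinear e c (c′ ∷ cs) = (λ y → c y - e y * c′ y) ∷ mulLinear e c′ cs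

  evalPoly-mulLinear : ∀ e c cs x y →
    evalPoly (mulLinear e c cs) x y ≡ c y + (x - e y) * evalPoly cs x y
  evalPoly-mulLinear e c []        x y = step (c y) x (e y)
    where
    step : ∀ c x e → c + x * 0ℤ ≡ c + (x - e) * 0ℤ
    step = solve-∀
  evalPoly-mulLinear e c (c′ ∷ cs) x y =
    trans (cong (λ t → c y - e y * c′ y + x * t) (evalPoly-mulLinear e c′ cs x y))
          (step (c y) (c′ y) x (e y) (evalPoly cs x y))
    where
    step : ∀ c c′ x e t → c - e * c′ + x * (c′ + (x - e) * t) ≡ c + (x - e) * (c′ + x * t)
    step = solve-∀

  length-mulLinear : ∀ e c cs → length (mulLinear e c cs) ≡ suc (length cs)
  length-mulLinear e c []        = refl
  length-mulLinear e c (c′ ∷ cs) = cong suc (length-mulLinear e c′ cs)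

  shiftedProduct : List ℤ → ℤ → ℤ → ℤ
  shiftedProduct []       x y = 1ℤ
  shiftedProduct (c ∷ cs) x y = (x - y - c) * shiftedProduct cs x y

  expand : List ℤ → CoeffPoly
  expand []       = (λ _ → 1ℤ) ∷ []
  expand (c ∷ cs) = mulLinear (λ y → y + c) (λ _ → 0ℤ) (expand cs)

  evalPoly-expand : ∀ cs x y → evalPoly (expand cs) x y ≡ shiftedProduct cs x y
  evalPoly-expand []       x y = cong (_+_ 1ℤ) (ℤP.*-zeroʳ x)
  evalPoly-expand (c ∷ cs) x y =
    trans (evalPoly-mulLinear (λ y → y + c) (λ _ → 0ℤ) (expand cs) x y)
          (trans (cong (λ t → 0ℤ + (x - (y + c)) * t) (evalPoly-expand cs x y))
                 (step x y c (shiftedProduct cs x y)))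
    where
    step : ∀ x y c t → 0ℤ + (x - (y + c)) * t ≡ (x - y - c) * t
    step = solve-∀

  length-expand : ∀ cs → length (expand cs) ≡ suc (length cs)
  length-expand []       = refl
  length-expand (c ∷ cs) =
    trans (length-mulLinear (λ y → y + c) (λ _ → 0ℤ) (expand cs)) (cong suc (length-expand cs))

  lowRank-shiftedProduct : ∀ cs → LowRank (shiftedProduct cs) (suc (length cs))
  lowRank-shiftedProduct cs =
    subst (LowRank (shiftedProduct cs)) (length-expand cs)
          (lowRank-resp (evalPoly-expand cs) (lowRank-poly (expand cs)))

  geometric : ℕ → ℤ → ℤ → ℤ
  geometric d x y = ∑[ j < d ] (x ^ toℕ j * y ^ (d ℕ.∸ suc (toℕ j)))

  lowRank-geometric : ∀ d → LowRank (geometric d) d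
  lowRank-geometric d = record
    { left = λ j x → x ^ toℕ j ; right = λ j y → y ^ (d ℕ.∸ suc (toℕ j))
    ; factorises = λ x y → refl }

  geometric-suc : ∀ d x y → geometric (suc d) x y ≡ y ^ d + x * geometric d x y
  geometric-suc d x y = cong₂ _+_ (ℤP.*-identityˡ (y ^ d)) (begin
    ∑[ j < d ] (x * x ^ toℕ j * y ^ (d ℕ.∸ suc (toℕ j)))
      ≡⟨ sum-cong-≗ {d} (λ j → ℤP.*-assoc x (x ^ toℕ j) _) ⟩
    ∑[ j < d ] (x * (x ^ toℕ j * y ^ (d ℕ.∸ suc (toℕ j))))
      ≡⟨ sym (*-distribˡ-sum {d} x (λ j → x ^ toℕ j * y ^ (d ℕ.∸ suc (toℕ j)))) ⟩
    x * geometric d x y ∎)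

  geometric-factor : ∀ d x y → (x - y) * geometric d x y ≡ x ^ d - y ^ d
  geometric-factor zero    x y = step x y
    where
    step : ∀ x y → (x - y) * 0ℤ ≡ 1ℤ - 1ℤ
    step = solve-∀
  geometric-factor (suc d) x y = begin
    (x - y) * geometric (suc d) x y
      ≡⟨ cong (_*_ (x - y)) (geometric-suc d x y) ⟩
    (x - y) * (y ^ d + x * geometric d x y)
      ≡⟨ expandOut x y (y ^ d) (geometric d x y) ⟩
    (x - y) * y ^ d + x * ((x - y) * geometric d x y)
      ≡⟨ cong (λ t → (x - y) * y ^ d + x * t) (geometric-factor d x y) ⟩
    (x - y) * y ^ d + x * (x ^ d - y ^ d)
      ≡⟨ collect x y (x ^ d) (y ^ d) ⟩
    x * x ^ d - y * y ^ d ∎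
    where
    expandOut : ∀ x y Y T → (x - y) * (Y + x * T) ≡ (x - y) * Y + x * ((x - y) * T)
    expandOut = solve-∀
    collect : ∀ x y X Y → (x - y) * Y + x * (X - Y) ≡ x * X - y * Y
    collect = solve-∀

  geometric-diagonal : ∀ d x → geometric (suc d) x x ≡ + suc d * x ^ d
  geometric-diagonal d x =
    trans (sum-cong-≗ {suc d} (λ j → trans (sym (ℤP.^-distribˡ-+-* x (toℕ j) (d ℕ.∸ toℕ j)))
                                           (cong (x ^_) (ℕP.m+[n∸m]≡n (ℕP.≤-pred (FinP.toℕ<n j))))))
          (sum-const (suc d) (x ^ d))

related-pair? : ∀ {X : Set} {R : X → X → Set} → (∀ x y → Dec (R x y)) → (L : List X) →
  Σ X (λ x → Σ X λ y → x ∈ L × y ∈ L × R x y) ⊎ (∀ x y → x ∈ L → y ∈ L → ¬ R x y)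
related-pair? R? L with Any.any? (λ x → Any.any? (R? x) L) L
... | no  none = inj₂ (λ x y x∈L y∈L xRy → none (lose x∈L (lose y∈L xRy)))
... | yes some with find some
...   | x , x∈L , some′ with find some′
...     | y , y∈L , xRy = inj₁ (x , y , x∈L , y∈L , xRy)

length-filter-split : ∀ {X : Set} {Pr : X → Set} (Pr? : Decidable Pr) (L : List X) →
  length (List.filter Pr? L) ℕ.+ length (List.filter (λ x → ¬? (Pr? x)) L) ≡ length L
length-filter-split Pr? []      = refl
length-filter-split Pr? (x ∷ L) with Pr? x
... | yes _ = cong suc (length-filter-split Pr? L)
... | no  _ = trans (ℕP.+-suc _ _) (cong suc (length-filter-split Pr? L))

module FibreCounting {X Y : Set} (_≟_ : DecidableEquality Y) (f : X → Y) (d : ℕ)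
  (fibre-bound : ∀ h (M : List X) → Unique M → (∀ {x} → x ∈ M → f x ≡ h) → length M ℕ.≤ d) where

  count-by-fibres : ∀ Hs (L : List X) → Unique L → (∀ {x} → x ∈ L → f x ∈ Hs) →
    length L ℕ.≤ d ℕ.* length Hs
  count-by-fibres []       []      _      _       = ℕ.z≤n
  count-by-fibres []       (x ∷ L) _      f[L]⊆[] with () ← f[L]⊆[] (here refl)
  count-by-fibres (h ∷ Hs) L       unique f[L]⊆Hs = begin
    length L                                  ≡⟨ length-filter-split in-fibre? L ⟨
    length (List.filter in-fibre? L) ℕ.+ length rest
                                              ≤⟨ ℕP.+-mono-≤ fibre rest-bound ⟩
    d ℕ.+ d ℕ.* length Hs                     ≡⟨ ℕP.*-suc d (length Hs) ⟨
    d ℕ.* length (h ∷ Hs)                     ∎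
    where
    open ℕP.≤-Reasoning
    in-fibre? : Decidable (λ x → f x ≡ h)
    in-fibre? x = f x ≟ h
    rest : List X
    rest = List.filter (λ x → ¬? (in-fibre? x)) L
    fibre : length (List.filter in-fibre? L) ℕ.≤ d
    fibre = fibre-bound h _ (Unique.filter⁺ in-fibre? unique)
      (λ x∈ → proj₂ (∈-filter⁻ in-fibre? {xs = L} x∈))
    rest-bound : length rest ℕ.≤ d ℕ.* length Hs
    rest-bound = count-by-fibres Hs rest (Unique.filter⁺ (λ x → ¬? (in-fibre? x)) unique) rest⊆Hs
      where
      rest⊆Hs : ∀ {x} → x ∈ rest → f x ∈ Hs
      rest⊆Hs x∈ with ∈-filter⁻ (λ x → ¬? (in-fibre? x)) {xs = L} x∈
      ... | x∈L , fx≢h with f[L]⊆Hs x∈L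
      ...   | here fx≡h  = ⊥-elim (fx≢h fx≡h)
      ...   | there fx∈Hs = fx∈Hs

-- Arithmetic modulo a fixed prime p, carried out on integers.
module ModPrime (p : ℕ) (p-prime : Prime p) where

  open ℤ using (ℤ; +_; 0ℤ; 1ℤ; _+_; _*_; _-_; -_; _^_)
  open Kernels
  open import Data.Integer.Divisibility.Signed
    using (_∣_; divides; ∣ᵤ⇒∣; ∣⇒∣ᵤ; ∣m∣n⇒∣m+n; ∣m⇒∣-m; ∣n⇒∣m*n; ∣m⇒∣m*n)

  instance
    p-nonZero : NonZero p
    p-nonZero = prime⇒nonZero p-prime

  1<p : 1 ℕ.< p
  1<p = ℕ.nonTrivial⇒n>1 p {{prime⇒nonTrivial p-prime}}

  0<p : 0 ℕ.< p
  0<p = ℕP.<-trans (ℕ.s≤s ℕ.z≤n) 1<p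

  P : ℤ
  P = + p

  P∣0 : P ∣ 0ℤ
  P∣0 = divides 0ℤ refl

  P∣*-split : ∀ a b → P ∣ a * b → P ∣ a ⊎ P ∣ b
  P∣*-split a b P∣ab with euclidsLemma ℤ.∣ a ∣ ℤ.∣ b ∣ p-prime (subst (p ℕD.∣_) (ℤP.abs-* a b) (∣⇒∣ᵤ P∣ab))
  ... | inj₁ p∣a = inj₁ (∣ᵤ⇒∣ p∣a)
  ... | inj₂ p∣b = inj₂ (∣ᵤ⇒∣ p∣b)

  P∤1 : ¬ P ∣ 1ℤ
  P∤1 P∣1 = ℕP.<⇒≢ 1<p (sym (ℕD.∣1⇒≡1 (∣⇒∣ᵤ P∣1)))

  P∤* : ∀ {a b} → ¬ P ∣ a → ¬ P ∣ b → ¬ P ∣ a * b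
  P∤* {a} {b} P∤a P∤b P∣ab = [ P∤a , P∤b ] (P∣*-split a b P∣ab)

  P∤^ : ∀ {a} n → ¬ P ∣ a → ¬ P ∣ a ^ n
  P∤^ zero    P∤a = P∤1
  P∤^ (suc n) P∤a = P∤* P∤a (P∤^ n P∤a)

  P∣sum : ∀ {N} (f : Fin N → ℤ) → (∀ i → P ∣ f i) → P ∣ sum f
  P∣sum {zero}  f P∣f = P∣0
  P∣sum {suc N} f P∣f = ∣m∣n⇒∣m+n (P∣f zero) (P∣sum (λ i → f (suc i)) (λ i → P∣f (suc i)))

  below-p-multiple : ∀ {m} → p ℕD.∣ m → m ℕ.< p → m ≡ 0
  below-p-multiple {zero}  _   _   = refl
  below-p-multiple {suc m} p∣m m<p = ⊥-elim (ℕD.>⇒∤ m<p p∣m)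

  infix 4 _≈_
  record _≈_ (a b : ℤ) : Set where
    constructor mod-p
    field divides-difference : P ∣ a - b
  open _≈_ public

  ≈-isEquivalence : IsEquivalence _≈_
  ≈-isEquivalence = record
    { refl = λ {a} → mod-p (subst (P ∣_) (sym (ℤP.+-inverseʳ a)) P∣0)
    ; sym = λ {a} {b} (mod-p P∣a-b) → mod-p (subst (P ∣_) (negate a b) (∣m⇒∣-m P∣a-b))
    ; trans = λ {a} {b} {c} (mod-p P∣a-b) (mod-p P∣b-c) →
        mod-p (subst (P ∣_) (telescope a b c) (∣m∣n⇒∣m+n P∣a-b P∣b-c)) }
    where
    negate : ∀ a b → - (a - b) ≡ b - a
    negate = solve-∀
    telescope : ∀ a b c → (a - b) + (b - c) ≡ a - c
    telescope = solve-∀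

  ≈-setoid : Setoid _ _
  ≈-setoid = record { isEquivalence = ≈-isEquivalence }

  open IsEquivalence ≈-isEquivalence public
    using () renaming (refl to ≈-refl; sym to ≈-sym; trans to ≈-trans; reflexive to ≡⇒≈)
  module ≈-Reasoning = SetoidReasoning ≈-setoid

  ≈-* : ∀ {a b c d} → a ≈ b → c ≈ d → a * c ≈ b * d
  ≈-* {a} {b} {c} {d} (mod-p P∣a-b) (mod-p P∣c-d) =
    mod-p (subst (P ∣_) (regroup a b c d) (∣m∣n⇒∣m+n (∣n⇒∣m*n a P∣c-d) (∣m⇒∣m*n d P∣a-b)))
    where
    regroup : ∀ a b c d → a * (c - d) + (a - b) * d ≡ a * c - b * d
    regroup = solve-∀

  ≈-+ : ∀ {a b c d} → a ≈ b → c ≈ d → a + c ≈ b + d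
  ≈-+ {a} {b} {c} {d} (mod-p P∣a-b) (mod-p P∣c-d) =
    mod-p (subst (P ∣_) (regroup a b c d) (∣m∣n⇒∣m+n P∣a-b P∣c-d))
    where
    regroup : ∀ a b c d → (a - b) + (c - d) ≡ a + c - (b + d)
    regroup = solve-∀

  ≈-*ˡ : ∀ a {b c} → b ≈ c → a * b ≈ a * c
  ≈-*ˡ a b≈c = ≈-* (≈-refl {a}) b≈c

  ≈-^ : ∀ {a b} n → a ≈ b → a ^ n ≈ b ^ n
  ≈-^ zero    a≈b = ≈-refl
  ≈-^ (suc n) a≈b = ≈-* a≈b (≈-^ n a≈b)

  ≈-cancelʳ : ∀ {a b c} → ¬ P ∣ c → a * c ≈ b * c → a ≈ b
  ≈-cancelʳ {a} {b} {c} P∤c (mod-p P∣ac-bc)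
    with P∣*-split (a - b) c (subst (P ∣_) (factor a b c) P∣ac-bc)
    where
    factor : ∀ a b c → a * c - b * c ≡ (a - b) * c
    factor = solve-∀
  ... | inj₁ P∣a-b = mod-p P∣a-b
  ... | inj₂ P∣c   = ⊥-elim (P∤c P∣c)

  ≈0⇒P∣ : ∀ {a} → a ≈ 0ℤ → P ∣ a
  ≈0⇒P∣ {a} (mod-p P∣a-0) = subst (P ∣_) (ℤP.+-identityʳ a) P∣a-0

  P∣⇒≈0 : ∀ {a} → P ∣ a → a ≈ 0ℤ
  P∣⇒≈0 {a} P∣a = mod-p (subst (P ∣_) (sym (ℤP.+-identityʳ a)) P∣a)

  ≈-% : ∀ s → + s ≈ + (s ℕ.% p)
  ≈-% s = mod-p (divides (+ (s ℕ./ p)) (begin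
    + s - + (s ℕ.% p)                      ≡⟨ cong (λ t → + t - + (s ℕ.% p)) (ℕDM.m≡m%n+[m/n]*n s p) ⟩
    + (s ℕ.% p ℕ.+ s ℕ./ p ℕ.* p) - + (s ℕ.% p)
      ≡⟨ cong (_- + (s ℕ.% p)) (trans (ℤP.pos-+ (s ℕ.% p) _) (cong (_+_ (+ (s ℕ.% p))) (ℤP.pos-* (s ℕ./ p) p))) ⟩
    + (s ℕ.% p) + + (s ℕ./ p) * P - + (s ℕ.% p) ≡⟨ cancel (+ (s ℕ.% p)) (+ (s ℕ./ p) * P) ⟩
    + (s ℕ./ p) * P ∎))
    where
    open ≡-Reasoning
    cancel : ∀ r m → r + m - r ≡ m
    cancel = solve-∀

  residue-injective : ∀ {a b} → a ℕ.< p → b ℕ.< p → + a ≈ + b → a ≡ b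
  residue-injective {a} {b} a<p b<p (mod-p P∣a-b) =
    ℤP.+-injective (ℤP.i-j≡0⇒i≡j (+ a) (+ b) (ℤP.∣i∣≡0⇒i≡0 (below-p-multiple (∣⇒∣ᵤ P∣a-b) distance<p)))
    where
    distance<p : ℤ.∣ + a - + b ∣ ℕ.< p
    distance<p = ℕP.≤-<-trans (subst (ℕ._≤ a ℕ.⊔ b) (cong ℤ.∣_∣ (sym (ℤP.m-n≡m⊖n a b))) (ℤP.∣m⊝n∣≤m⊔n a b))
                              (ℕP.⊔-lub a<p b<p)

  P∤residue : ∀ {a} → a ≢ 0 → a ℕ.< p → ¬ P ∣ + a
  P∤residue {a} a≢0 a<p P∣a = a≢0 (residue-injective a<p 0<p (P∣⇒≈0 P∣a))

  ⟦_⟧ : Fin p → ℤ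
  ⟦ a ⟧ = + toℕ a

  ⟦⟧-injective : ∀ {a b} → ⟦ a ⟧ ≈ ⟦ b ⟧ → a ≡ b
  ⟦⟧-injective {a} {b} a≈b = FinP.toℕ-injective (residue-injective (FinP.toℕ<n a) (FinP.toℕ<n b) a≈b)

  ⟦-ₚ⟧ : ∀ a b → ⟦ a -ₚ b ⟧ ≈ ⟦ a ⟧ - ⟦ b ⟧
  ⟦-ₚ⟧ a b = begin
    ⟦ a -ₚ b ⟧                ≡⟨ cong +_ (FinP.toℕ-fromℕ< (ℕDM.m%n<n s p)) ⟩
    + (s ℕ.% p)               ≈⟨ ≈-% s ⟨
    + s                       ≡⟨ trans (ℤP.pos-+ (toℕ a) (p ℕ.∸ toℕ b)) (cong (_+_ ⟦ a ⟧) p-b) ⟩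
    ⟦ a ⟧ + (P - ⟦ b ⟧)       ≈⟨ mod-p (divides 1ℤ (drop-P ⟦ a ⟧ ⟦ b ⟧ P)) ⟩
    ⟦ a ⟧ - ⟦ b ⟧             ∎
    where
    open ≈-Reasoning
    s : ℕ
    s = toℕ a ℕ.+ (p ℕ.∸ toℕ b)
    p-b : + (p ℕ.∸ toℕ b) ≡ P - ⟦ b ⟧
    p-b = sym (trans (ℤP.m-n≡m⊖n p (toℕ b)) (ℤP.⊖-≥ (ℕP.<⇒≤ (FinP.toℕ<n b))))
    drop-P : ∀ a b P → a + (P - b) - (a - b) ≡ 1ℤ * P
    drop-P = solve-∀

  ⟦^⟧ : ∀ x k → + ((toℕ x ℕ.^ k) ℕ.% p) ≈ ⟦ x ⟧ ^ k
  ⟦^⟧ x k = ≈-trans (≈-sym (≈-% (toℕ x ℕ.^ k))) (≡⇒≈ (pos-^ (toℕ x) k))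
    where
    pos-^ : ∀ m n → + (m ℕ.^ n) ≡ (+ m) ^ n
    pos-^ m zero    = refl
    pos-^ m (suc n) = trans (ℤP.pos-* m (m ℕ.^ n)) (cong (_*_ (+ m)) (pos-^ m n))

module RankBound (p : ℕ) (p-prime : Prime p) where

  open ℤ using (ℤ; 0ℤ; 1ℤ; _+_; _*_; _-_; -_)
  open Kernels
  open ModPrime p p-prime
  open import Data.Integer.Divisibility.Signed
    using (_∣_; _∣?_; ∣m∣n⇒∣m+n; ∣n⇒∣m*n; ∣m⇒∣m*n; ∣m+n∣m⇒∣n; ∣m+n∣n⇒∣m)

  P∣remaining-term : ∀ {N} (f : Fin N → ℤ) (j : Fin N) →
    P ∣ sum f → (∀ i → i ≢ j → P ∣ f i) → P ∣ f j
  P∣remaining-term {suc N} f zero    P∣Σf P∣others =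
    ∣m+n∣n⇒∣m P∣Σf (P∣sum (λ i → f (suc i)) (λ i → P∣others (suc i) (λ ())))
  P∣remaining-term {suc N} f (suc j) P∣Σf P∣others =
    P∣remaining-term (λ i → f (suc i)) j (∣m+n∣m⇒∣n P∣Σf (P∣others zero (λ ())))
      (λ i i≢j → P∣others (suc i) (λ i+1≡j+1 → i≢j (FinP.suc-injective i+1≡j+1)))

  dot : ∀ {N} → (Fin N → ℤ) → (Fin N → ℤ) → ℤ
  dot {N} a x = ∑[ j < N ] (a j * x j)

  dot-linear : ∀ {N} α β (a b x : Fin N → ℤ) →
    dot (λ j → α * a j - β * b j) x ≡ α * dot a x - β * dot b x
  dot-linear {zero}  α β a b x = vanish α β
    where
    vanish : ∀ α β → 0ℤ ≡ α * 0ℤ - β * 0ℤ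
    vanish = solve-∀
  dot-linear {suc N} α β a b x =
    trans (cong (_+_ ((α * a zero - β * b zero) * x zero))
                (dot-linear α β (λ j → a (suc j)) (λ j → b (suc j)) (λ j → x (suc j))))
          (distribute α β (a zero) (b zero) (x zero) _ _)
    where
    distribute : ∀ α β a b x A B → (α * a - β * b) * x + (α * A - β * B) ≡ α * (a * x + A) - β * (b * x + B)
    distribute = solve-∀

  NontrivialSolution : ∀ {R N} → (Fin R → Fin N → ℤ) → Set
  NontrivialSolution {R} {N} rows =
    Σ (Fin N → ℤ) λ x → (∀ r → P ∣ dot (rows r) x) × Σ (Fin N) λ j → ¬ P ∣ x j

  -- Gaussian elimination of the first unknown against the pivot row r₀.
  reduce : ∀ {R N} → (Fin (suc R) → Fin (suc N) → ℤ) → Fin (suc R) → Fin R → Fin N → ℤ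
  reduce rows r₀ i j = rows r₀ zero * rows (Fin.punchIn r₀ i) (suc j)
                     - rows (Fin.punchIn r₀ i) zero * rows r₀ (suc j)

  backSubstitute : ∀ {N} → ℤ → ℤ → (Fin N → ℤ) → Fin (suc N) → ℤ
  backSubstitute c S y zero    = - S
  backSubstitute c S y (suc j) = c * y j

  dot-backSubstitute : ∀ {N} (a : Fin (suc N) → ℤ) c S (y : Fin N → ℤ) →
    dot a (backSubstitute c S y) ≡ c * dot (λ j → a (suc j)) y - a zero * S
  dot-backSubstitute {N} a c S y = begin
    a zero * - S + ∑[ j < N ] (a (suc j) * (c * y j))
      ≡⟨ cong (_+_ (a zero * - S)) (sum-cong-≗ {N} (λ j → swap (a (suc j)) c (y j))) ⟩
    a zero * - S + ∑[ j < N ] (c * (a (suc j) * y j))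
      ≡⟨ cong (_+_ (a zero * - S)) (sym (*-distribˡ-sum {N} c (λ j → a (suc j) * y j))) ⟩
    a zero * - S + c * dot (λ j → a (suc j)) y
      ≡⟨ reorder (a zero) S c _ ⟩
    c * dot (λ j → a (suc j)) y - a zero * S ∎
    where
    open ≡-Reasoning
    swap : ∀ a c y → a * (c * y) ≡ c * (a * y)
    swap = solve-∀
    reorder : ∀ a S c T → a * - S + c * T ≡ c * T - a * S
    reorder = solve-∀

  pivot-step : ∀ {R N} (rows : Fin (suc R) → Fin (suc N) → ℤ) (r₀ : Fin (suc R)) →
    ¬ P ∣ rows r₀ zero → NontrivialSolution (reduce rows r₀) → NontrivialSolution rows
  pivot-step {R} rows r₀ P∤c (y , y-solves , j , P∤yj) =
    backSubstitute c S y , solves , suc j , P∤* P∤c P∤yj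
    where
    c S : ℤ
    c = rows r₀ zero
    S = dot (λ j → rows r₀ (suc j)) y
    solves : ∀ r → P ∣ dot (rows r) (backSubstitute c S y)
    solves r with r FinP.≟ r₀
    ... | yes refl = subst (P ∣_) (sym (trans (dot-backSubstitute (rows r₀) c S y) (ℤP.+-inverseʳ (c * S)))) P∣0
    ... | no r≢r₀  = subst (P ∣_) reduced≡ (y-solves i)
      where
      i : Fin R
      i = Fin.punchOut (λ r₀≡r → r≢r₀ (sym r₀≡r))
      reduced≡ : dot (reduce rows r₀ i) y ≡ dot (rows r) (backSubstitute c S y)
      reduced≡ = begin
        dot (reduce rows r₀ i) y
          ≡⟨ dot-linear c (rows (Fin.punchIn r₀ i) zero) (λ j → rows (Fin.punchIn r₀ i) (suc j)) (λ j → rows r₀ (suc j)) y ⟩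
        c * dot (λ j → rows (Fin.punchIn r₀ i) (suc j)) y - rows (Fin.punchIn r₀ i) zero * S
          ≡⟨ cong (λ r′ → c * dot (λ j → rows r′ (suc j)) y - rows r′ zero * S)
                  (FinP.punchIn-punchOut (λ r₀≡r → r≢r₀ (sym r₀≡r))) ⟩
        c * dot (λ j → rows r (suc j)) y - rows r zero * S
          ≡⟨ sym (dot-backSubstitute (rows r) c S y) ⟩
        dot (rows r) (backSubstitute c S y) ∎
        where open ≡-Reasoning

  firstUnit : ∀ {N} → Fin (suc N) → ℤ
  firstUnit zero    = 1ℤ
  firstUnit (suc j) = 0ℤ

  dot-firstUnit : ∀ {N} (a : Fin (suc N) → ℤ) → P ∣ a zero → P ∣ dot a firstUnit
  dot-firstUnit a P∣a₀ = ∣m∣n⇒∣m+n (∣m⇒∣m*n 1ℤ P∣a₀) (P∣sum _ (λ j → ∣n⇒∣m*n (a (suc j)) P∣0))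

  homogeneous-solution : ∀ N R → R ℕ.< N → (rows : Fin R → Fin N → ℤ) → NontrivialSolution rows
  homogeneous-solution (suc N) zero    _ rows = firstUnit , (λ ()) , zero , P∤1
  homogeneous-solution (suc N) (suc R) (ℕ.s≤s R<N) rows
    with FinP.any? (λ r → ¬? (P ∣? rows r zero))
  ... | yes (r₀ , P∤c) = pivot-step rows r₀ P∤c (homogeneous-solution N R R<N (reduce rows r₀))
  ... | no  no-pivot   =
    firstUnit , (λ r → dot-firstUnit (rows r) (decidable-stable (P ∣? rows r zero) (λ P∤ → no-pivot (r , P∤)))) ,
    zero , P∤1

  lookup-injective : ∀ {X : Set} {S : List X} → Unique S →
    ∀ i j → List.lookup S i ≡ List.lookup S j → i ≡ j
  lookup-injective (_ AllPairs.∷ _)        zero    zero    _  = refl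
  lookup-injective (x∉S AllPairs.∷ _)      zero    (suc j) eq = ⊥-elim (All.lookup x∉S (∈-lookup j) eq)
  lookup-injective (x∉S AllPairs.∷ _)      (suc i) zero    eq = ⊥-elim (All.lookup x∉S (∈-lookup i) (sym eq))
  lookup-injective (_ AllPairs.∷ unique)   (suc i) (suc j) eq = cong suc (lookup-injective unique i j eq)

  -- If K has rank at most R and, on a duplicate-free list S,
  -- the matrix (K(s, s′))_{s,s′ ∈ S} is diagonal modulo p with diagonal entries
  -- not ≡ 0, then |S| ≤ R: a diagonal matrix of full rank |S| mod p cannot
  -- factor through ℤ^R.
  rank-bound : ∀ {X : Set} {K : X → X → ℤ} {R} → LowRank K R → (S : List X) → Unique S →
    (∀ {x} → x ∈ S → ¬ P ∣ K x x) → (∀ {x y} → x ∈ S → y ∈ S → x ≢ y → P ∣ K x y) →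
    length S ℕ.≤ R
  rank-bound {X} {K} {R} rk S unique diagonal off-diagonal = ℕP.≮⇒≥ too-many-points
    where
    open LowRank rk
    N : ℕ
    N = length S
    s : Fin N → X
    s = List.lookup S
    too-many-points : R ℕ.< N → ⊥
    too-many-points R<N = [ diagonal (∈-lookup j₀) , P∤μj₀ ] (P∣*-split (K a a) (μ j₀) P∣diagonal-term)
      where
      -- μ is a nontrivial relation mod p among the N columns right(s_j) ∈ ℤ^R.
      relation : NontrivialSolution (λ r j → right r (s j))
      relation = homogeneous-solution N R R<N (λ r j → right r (s j))
      μ : Fin N → ℤ
      μ = proj₁ relation
      j₀ : Fin N
      j₀ = proj₁ (proj₂ (proj₂ relation))
      P∤μj₀ : ¬ P ∣ μ j₀
      P∤μj₀ = proj₂ (proj₂ (proj₂ relation))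
      a : X
      a = s j₀
      -- Applying the relation to the row of a: Σ_j K(a, s_j) μ_j ≡ 0.
      row-sum : ∑[ j < N ] (K a (s j) * μ j) ≡ ∑[ r < R ] (left r a * dot (λ j → right r (s j)) μ)
      row-sum = begin
        ∑[ j < N ] (K a (s j) * μ j)
          ≡⟨ sum-cong-≗ {N} (λ j → trans (cong (_* μ j) (factorises a (s j)))
                                        (*-distribʳ-sum (μ j) (λ r → left r a * right r (s j)))) ⟩
        ∑[ j < N ] ∑[ r < R ] (left r a * right r (s j) * μ j)
          ≡⟨ ∑-comm (λ j r → left r a * right r (s j) * μ j) ⟩
        ∑[ r < R ] ∑[ j < N ] (left r a * right r (s j) * μ j)
          ≡⟨ sum-cong-≗ {R} (λ r → trans (sum-cong-≗ {N} (λ j → ℤP.*-assoc (left r a) (right r (s j)) (μ j)))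
                                         (sym (*-distribˡ-sum (left r a) (λ j → right r (s j) * μ j)))) ⟩
        ∑[ r < R ] (left r a * dot (λ j → right r (s j)) μ) ∎
        where open ≡-Reasoning
      P∣row-sum : P ∣ ∑[ j < N ] (K a (s j) * μ j)
      P∣row-sum = subst (P ∣_) (sym row-sum)
        (P∣sum _ (λ r → ∣n⇒∣m*n (left r a) (proj₁ (proj₂ relation) r)))
      -- All other terms vanish mod p, so the diagonal term does too.
      P∣diagonal-term : P ∣ K a a * μ j₀
      P∣diagonal-term = P∣remaining-term (λ j → K a (s j) * μ j) j₀ P∣row-sum
        (λ j j≢j₀ → ∣m⇒∣m*n (μ j) (off-diagonal (∈-lookup j₀) (∈-lookup j)
                      (λ a≡sj → j≢j₀ (sym (lookup-injective unique j₀ j a≡sj)))))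

module Fermat (p : ℕ) (p-prime : Prime p) where

  open ℤ using (ℤ; +_; 0ℤ; 1ℤ; _+_; _*_; _-_; _^_)
  open Kernels
  open ModPrime p p-prime
  open import Data.Integer.Divisibility.Signed using (_∣_; ∣ᵤ⇒∣; ∣m⇒∣m*n)
  open import Algebra.Properties.CommutativeSemiring.Binomial ℤP.+-*-commutativeSemiring
    using (binomialTerm) renaming (theorem to binomial-theorem)
  open import Algebra.Properties.Semiring.Exp ℤP.+-*-semiring using () renaming (_^_ to _^ₛ_)
  open import Algebra.Properties.Semiring.Mult ℤP.+-*-semiring using () renaming (_×_ to _×ₛ_)

  p∤factorial : ∀ m → m ℕ.< p → ¬ p ℕD.∣ m ℕ.!
  p∤factorial zero    _   p∣1 = P∤1 (∣ᵤ⇒∣ p∣1)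
  p∤factorial (suc m) m<p p∣m! with euclidsLemma (suc m) (m ℕ.!) p-prime p∣m!
  ... | inj₁ p∣m+1 = ℕP.<⇒≱ m<p (ℕD.∣⇒≤ p∣m+1)
  ... | inj₂ p∣m!′ = p∤factorial m (ℕP.<-trans (ℕP.n<1+n m) m<p) p∣m!′

  -- p divides the inner binomial coefficients C(p, k), 0 < k < p, since
  -- C(p, k) · k! · (p − k)! = p! and p divides neither k! nor (p − k)!.
  p∣choose : ∀ k → 0 ℕ.< k → k ℕ.< p → p ℕD.∣ p C k
  p∣choose k 0<k k<p with euclidsLemma (p C k) (k ℕ.! ℕ.* (p ℕ.∸ k) ℕ.!) p-prime p∣product
    where
    instance
      factorials-nonZero : NonZero (k ℕ.! ℕ.* (p ℕ.∸ k) ℕ.!)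
      factorials-nonZero = ℕP._!*_!≢0 k (p ℕ.∸ k)
    product≡p! : (p C k) ℕ.* (k ℕ.! ℕ.* (p ℕ.∸ k) ℕ.!) ≡ p ℕ.!
    product≡p! = trans (cong (λ c → c ℕ.* (k ℕ.! ℕ.* (p ℕ.∸ k) ℕ.!)) (nCk≡n!/k![n-k]! (ℕP.<⇒≤ k<p)))
                       (ℕDM.m/n*n≡m (k![n∸k]!∣n! (ℕP.<⇒≤ k<p)))
    p∣product : p ℕD.∣ (p C k) ℕ.* (k ℕ.! ℕ.* (p ℕ.∸ k) ℕ.!)
    p∣product = subst (p ℕD.∣_) (sym product≡p!)
                      (subst (λ n → n ℕD.∣ n ℕ.!) (ℕP.suc-pred p) (ℕD.m∣m*n (ℕ.pred p ℕ.!)))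
  ... | inj₁ p∣C = p∣C
  ... | inj₂ p∣k!*[p-k]! with euclidsLemma (k ℕ.!) ((p ℕ.∸ k) ℕ.!) p-prime p∣k!*[p-k]!
  ...   | inj₁ p∣k!     = ⊥-elim (p∤factorial k k<p p∣k!)
  ...   | inj₂ p∣[p-k]! = ⊥-elim (p∤factorial (p ℕ.∸ k) (ℕP.∸-monoʳ-< 0<k (ℕP.<⇒≤ k<p)) p∣[p-k]!)

  -- The binomial theorem of the library is stated with the semiring's own
  -- exponentiation and natural-number multiples, which agree with ℤ's.
  semiring-^ : ∀ x n → x ^ₛ n ≡ x ^ n
  semiring-^ x zero    = refl
  semiring-^ x (suc n) = cong (_*_ x) (semiring-^ x n)

  semiring-× : ∀ n x → n ×ₛ x ≡ + n * x
  semiring-× zero    x = sym (ℤP.*-zeroˡ x)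
  semiring-× (suc n) x = trans (cong (_+_ x) (semiring-× n x)) (sym (ℤP.suc-* (+ n) x))

  binomialTerm-x+1 : ∀ x n k → binomialTerm x 1ℤ n k ≡ + (n C toℕ k) * x ^ toℕ k
  binomialTerm-x+1 x n k = begin
    (n C toℕ k) ×ₛ (x ^ₛ toℕ k * 1ℤ ^ₛ (n ℕ.∸ toℕ k))
      ≡⟨ semiring-× (n C toℕ k) _ ⟩
    + (n C toℕ k) * (x ^ₛ toℕ k * 1ℤ ^ₛ (n ℕ.∸ toℕ k))
      ≡⟨ cong₂ (λ a b → + (n C toℕ k) * (a * b)) (semiring-^ x (toℕ k))
               (trans (semiring-^ 1ℤ (n ℕ.∸ toℕ k)) (ℤP.^-zeroˡ (n ℕ.∸ toℕ k))) ⟩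
    + (n C toℕ k) * (x ^ toℕ k * 1ℤ)
      ≡⟨ cong (_*_ (+ (n C toℕ k))) (ℤP.*-identityʳ (x ^ toℕ k)) ⟩
    + (n C toℕ k) * x ^ toℕ k ∎
    where open ≡-Reasoning

  inner-binomials⇒binomial≈ : ∀ n .{{_ : NonZero n}} →
    (∀ k → 0 ℕ.< k → k ℕ.< n → p ℕD.∣ n C k) → ∀ x → (x + 1ℤ) ^ n ≈ x ^ n + 1ℤ
  inner-binomials⇒binomial≈ (suc q) p∣inner x = mod-p (subst (P ∣_) (sym difference≡middle) P∣middle)
    where
    n : ℕ
    n = suc q
    term : Fin (suc n) → ℤ
    term = binomialTerm x 1ℤ n
    middle : ℤ
    middle = ∑[ j < q ] term (suc (Fin.inject₁ j))
    P∣middle : P ∣ middle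
    P∣middle = P∣sum (λ j → term (suc (Fin.inject₁ j))) P∣inner-term
      where
      P∣inner-term : ∀ j → P ∣ term (suc (Fin.inject₁ j))
      P∣inner-term j = subst (P ∣_) (sym (binomialTerm-x+1 x n k))
                              (∣m⇒∣m*n {m = + (n C toℕ k)} (x ^ toℕ k) (∣ᵤ⇒∣ (p∣inner (toℕ k) (ℕ.s≤s ℕ.z≤n) k<n)))
        where
        k : Fin (suc n)
        k = suc (Fin.inject₁ j)
        k<n : toℕ k ℕ.< n
        k<n = ℕ.s≤s (subst (ℕ._< q) (sym (FinP.toℕ-inject₁ j)) (FinP.toℕ<n j))
    first : term zero ≡ 1ℤ
    first = binomialTerm-x+1 x n zero
    last : term (Fin.fromℕ n) ≡ x ^ n
    last = trans (binomialTerm-x+1 x n (Fin.fromℕ n))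
                 (trans (cong (λ m → + (n C m) * x ^ m) (FinP.toℕ-fromℕ n))
                        (trans (cong (λ c → + c * x ^ n) (nCn≡1 n)) (ℤP.*-identityˡ (x ^ n))))
    difference≡middle : (x + 1ℤ) ^ n - (x ^ n + 1ℤ) ≡ middle
    difference≡middle = begin
      (x + 1ℤ) ^ n - (x ^ n + 1ℤ)
        ≡⟨ cong (_- (x ^ n + 1ℤ)) (trans (sym (semiring-^ (x + 1ℤ) n)) (binomial-theorem n x 1ℤ)) ⟩
      sum term - (x ^ n + 1ℤ)
        ≡⟨ cong (_- (x ^ n + 1ℤ)) (sum-init-last term) ⟩
      (term zero + middle) + term (Fin.fromℕ n) - (x ^ n + 1ℤ)
        ≡⟨ cong₂ (λ a b → (a + middle) + b - (x ^ n + 1ℤ)) first last ⟩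
      (1ℤ + middle) + x ^ n - (x ^ n + 1ℤ)
        ≡⟨ cancel middle (x ^ n) ⟩
      middle ∎
      where
      open ≡-Reasoning
      cancel : ∀ M X → (1ℤ + M) + X - (X + 1ℤ) ≡ M
      cancel = solve-∀

  fermat-^p : ∀ a → (+ a) ^ p ≈ + a
  fermat-^p zero    = ≡⇒≈ (zero-^ p)
    where
    zero-^ : ∀ n .{{_ : NonZero n}} → 0ℤ ^ n ≡ 0ℤ
    zero-^ (suc n) = refl
  fermat-^p (suc a) = begin
    (+ suc a) ^ p       ≡⟨ cong (_^ p) suc≡+1 ⟩
    (+ a + 1ℤ) ^ p      ≈⟨ inner-binomials⇒binomial≈ p p∣choose (+ a) ⟩
    (+ a) ^ p + 1ℤ      ≈⟨ ≈-+ (fermat-^p a) ≈-refl ⟩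
    + a + 1ℤ            ≡⟨ suc≡+1 ⟨
    + suc a             ∎
    where
    open ≈-Reasoning
    suc≡+1 : + suc a ≡ + a + 1ℤ
    suc≡+1 = trans (ℤP.pos-+ 1 a) (ℤP.+-comm 1ℤ (+ a))

  fermat : ∀ a → ¬ P ∣ + a → (+ a) ^ (p ℕ.∸ 1) ≈ 1ℤ
  fermat a P∤a = ≈-cancelʳ P∤a (begin
    (+ a) ^ (p ℕ.∸ 1) * + a   ≡⟨ ℤP.*-comm _ (+ a) ⟩
    (+ a) ^ suc (p ℕ.∸ 1)     ≡⟨ cong ((+ a) ^_) (ℕP.suc-pred p) ⟩
    (+ a) ^ p                 ≈⟨ fermat-^p a ⟩
    + a                       ≡⟨ sym (ℤP.*-identityˡ (+ a)) ⟩
    1ℤ * + a                  ∎)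
    where open ≈-Reasoning

  fermat-multiple : ∀ {a} → ¬ P ∣ + a → ∀ v → (+ a) ^ (v ℕ.* (p ℕ.∸ 1)) ≈ 1ℤ
  fermat-multiple {a} P∤a v = begin
    (+ a) ^ (v ℕ.* (p ℕ.∸ 1))    ≡⟨ ^-by-product (+ a) v (p ℕ.∸ 1) ⟩
    ((+ a) ^ (p ℕ.∸ 1)) ^ v      ≈⟨ ≈-^ v (fermat a P∤a) ⟩
    1ℤ ^ v                       ≡⟨ ℤP.^-zeroˡ v ⟩
    1ℤ                           ∎
    where open ≈-Reasoning

  -- Bézout writes d as a combination of
  -- k and p − 1, and the (p − 1)-th powers are 1 by Fermat.
  gcd-power : ∀ k {a b} → ¬ P ∣ + a → ¬ P ∣ + b → (+ a) ^ k ≈ (+ b) ^ k →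
    (+ a) ^ gcd k (p ℕ.∸ 1) ≈ (+ b) ^ gcd k (p ℕ.∸ 1)
  gcd-power k {a} {b} P∤a P∤b a^k≈b^k with Bézout.identity (gcd-GCD k (p ℕ.∸ 1))
  ... | Bézout.+- u v d+v[p-1]≡uk = begin
    (+ a) ^ d                 ≈⟨ collapse P∤a ⟨
    (+ a) ^ (u ℕ.* k)         ≡⟨ ^-by-product (+ a) u k ⟩
    ((+ a) ^ k) ^ u           ≈⟨ ≈-^ u a^k≈b^k ⟩
    ((+ b) ^ k) ^ u           ≡⟨ ^-by-product (+ b) u k ⟨
    (+ b) ^ (u ℕ.* k)         ≈⟨ collapse P∤b ⟩
    (+ b) ^ d                 ∎
    where
    open ≈-Reasoning
    d : ℕ
    d = gcd k (p ℕ.∸ 1)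
    collapse : ∀ {c} → ¬ P ∣ + c → (+ c) ^ (u ℕ.* k) ≈ (+ c) ^ d
    collapse {c} P∤c = begin
      (+ c) ^ (u ℕ.* k)                          ≡⟨ cong (_^_ (+ c)) d+v[p-1]≡uk ⟨
      (+ c) ^ (d ℕ.+ v ℕ.* (p ℕ.∸ 1))            ≡⟨ ℤP.^-distribˡ-+-* (+ c) d _ ⟩
      (+ c) ^ d * (+ c) ^ (v ℕ.* (p ℕ.∸ 1))      ≈⟨ ≈-*ˡ ((+ c) ^ d) (fermat-multiple P∤c v) ⟩
      (+ c) ^ d * 1ℤ                             ≡⟨ ℤP.*-identityʳ _ ⟩
      (+ c) ^ d                                  ∎
  ... | Bézout.-+ u v d+uk≡v[p-1] = ≈-cancelʳ {(+ a) ^ d} {(+ b) ^ d} (P∤^ u (P∤^ k P∤a)) (begin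
    (+ a) ^ d * ((+ a) ^ k) ^ u     ≈⟨ unit P∤a ⟩
    1ℤ                              ≈⟨ unit P∤b ⟨
    (+ b) ^ d * ((+ b) ^ k) ^ u     ≈⟨ ≈-*ˡ ((+ b) ^ d) (≈-^ u (≈-sym a^k≈b^k)) ⟩
    (+ b) ^ d * ((+ a) ^ k) ^ u     ∎)
    where
    open ≈-Reasoning
    d : ℕ
    d = gcd k (p ℕ.∸ 1)
    unit : ∀ {c} → ¬ P ∣ + c → (+ c) ^ d * ((+ c) ^ k) ^ u ≈ 1ℤ
    unit {c} P∤c = begin
      (+ c) ^ d * ((+ c) ^ k) ^ u      ≡⟨ cong (_*_ ((+ c) ^ d)) (^-by-product (+ c) u k) ⟨
      (+ c) ^ d * (+ c) ^ (u ℕ.* k)    ≡⟨ ℤP.^-distribˡ-+-* (+ c) d (u ℕ.* k) ⟨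
      (+ c) ^ (d ℕ.+ u ℕ.* k)          ≡⟨ cong (_^_ (+ c)) d+uk≡v[p-1] ⟩
      (+ c) ^ (v ℕ.* (p ℕ.∸ 1))        ≈⟨ fermat-multiple P∤c v ⟩
      1ℤ                               ∎

module PowerResidues (p : ℕ) (p-prime : Prime p) (k : ℕ) (0<k : 0 ℕ.< k) where

  open ℤ using (ℤ; +_; _*_; _-_; _^_)
  open Kernels
  open ModPrime p p-prime
  open RankBound p p-prime
  open Fermat p p-prime
  open import Data.Integer.Divisibility.Signed using (_∣_; _∣?_)

  d : ℕ
  d = gcd k (p ℕ.∸ 1)

  0<d : 0 ℕ.< d
  0<d = ℕP.n≢0⇒n>0 (gcd[m,n]≢0 k (p ℕ.∸ 1) (inj₁ (ℕP.n>0⇒n≢0 0<k)))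

  instance
    d-nonZero : NonZero d
    d-nonZero = ℕ.>-nonZero 0<d

  d<p : d ℕ.< p
  d<p = ℕP.<-≤-trans (ℕ.s≤s (ℕD.∣⇒≤ {{ℕ.>-nonZero (ℕP.m<n⇒0<n∸m 1<p)}} (gcd[m,n]∣n k (p ℕ.∸ 1))))
                     (ℕP.≤-reflexive (ℕP.suc-pred p))

  power : Fin p → Fin p
  power x = Fin.fromℕ< (ℕDM.m%n<n (toℕ x ℕ.^ k) p)

  toℕ-power : ∀ x → toℕ (power x) ≡ (toℕ x ℕ.^ k) ℕ.% p
  toℕ-power x = FinP.toℕ-fromℕ< (ℕDM.m%n<n (toℕ x ℕ.^ k) p)

  power-residue : ∀ x → Q k (power x)
  power-residue x = x , sym (toℕ-power x)

  ⟦power⟧ : ∀ x → ⟦ power x ⟧ ≈ ⟦ x ⟧ ^ k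
  ⟦power⟧ x = subst (_≈ ⟦ x ⟧ ^ k) (cong +_ (sym (toℕ-power x))) (⟦^⟧ x k)

  0^k%p≡0 : (0 ℕ.^ k) ℕ.% p ≡ 0
  0^k%p≡0 = trans (cong (ℕ._% p) (0^n≡0 k 0<k)) (ℕDM.m<n⇒m%n≡m 0<p)
    where
    0^n≡0 : ∀ n → 0 ℕ.< n → 0 ℕ.^ n ≡ 0
    0^n≡0 (suc n) _ = refl

  power≡0 : ∀ x → toℕ (power x) ≡ 0 → toℕ x ≡ 0
  power≡0 x x^k≡0 with P ∣? ⟦ x ⟧
  ... | yes P∣x = residue-injective (FinP.toℕ<n x) 0<p (P∣⇒≈0 P∣x)
  ... | no  P∤x = ⊥-elim (P∤^ k P∤x (≈0⇒P∣ (≈-trans (≈-sym (⟦power⟧ x)) (≡⇒≈ (cong +_ x^k≡0)))))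

  at-most-one-zero : ∀ (M : List (Fin p)) → Unique M → (∀ {x} → x ∈ M → toℕ x ≡ 0) → length M ℕ.≤ 1
  at-most-one-zero []          _                  _        = ℕ.z≤n
  at-most-one-zero (x ∷ [])    _                  _        = ℕ.s≤s ℕ.z≤n
  at-most-one-zero (x ∷ y ∷ _) (x∉ AllPairs.∷ _) all-zero =
    ⊥-elim (All.lookup x∉ (here refl)
      (FinP.toℕ-injective (trans (all-zero (here refl)) (sym (all-zero (there (here refl)))))))

  -- A non-zero fibre of the power map has at most d elements: for x ≠ y in it,
  -- x^k ≡ y^k gives x^d ≡ y^d, so the geometric kernel T_d vanishes mod p
  -- (as (x − y) T_d(x, y) = x^d − y^d), while T_d(x, x) = d x^(d−1) does not;
  -- the rank bound for T_d gives the claim.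
  nonzero-fibre-bound : ∀ h → toℕ h ≢ 0 → (M : List (Fin p)) → Unique M →
    (∀ {x} → x ∈ M → power x ≡ h) → length M ℕ.≤ d
  nonzero-fibre-bound h h≢0 M unique in-fibre =
    rank-bound (lowRank-pullback ⟦_⟧ (lowRank-geometric d)) M unique diagonal off-diagonal
    where
    P∤element : ∀ {x} → x ∈ M → ¬ P ∣ ⟦ x ⟧
    P∤element {x} x∈M P∣x = h≢0 (begin
      toℕ h                      ≡⟨ cong toℕ (in-fibre x∈M) ⟨
      toℕ (power x)              ≡⟨ toℕ-power x ⟩
      (toℕ x ℕ.^ k) ℕ.% p        ≡⟨ cong (λ t → (t ℕ.^ k) ℕ.% p) (residue-injective (FinP.toℕ<n x) 0<p (P∣⇒≈0 P∣x)) ⟩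
      (0 ℕ.^ k) ℕ.% p            ≡⟨ 0^k%p≡0 ⟩
      0                          ∎)
      where open ≡-Reasoning
    diagonal : ∀ {x} → x ∈ M → ¬ P ∣ geometric d ⟦ x ⟧ ⟦ x ⟧
    diagonal {x} x∈M with d | 0<d | d<p
    ... | suc e | _ | e<p = subst (λ t → ¬ P ∣ t) (sym (geometric-diagonal e ⟦ x ⟧))
                              (P∤* (P∤residue (λ ()) e<p) (P∤^ e (P∤element x∈M)))
    off-diagonal : ∀ {x y} → x ∈ M → y ∈ M → x ≢ y → P ∣ geometric d ⟦ x ⟧ ⟦ y ⟧
    off-diagonal {x} {y} x∈M y∈M x≢y =
      [ (λ P∣x-y → ⊥-elim (x≢y (⟦⟧-injective (mod-p P∣x-y)))) , (λ P∣T → P∣T) ]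
        (P∣*-split (⟦ x ⟧ - ⟦ y ⟧) _ (subst (P ∣_) (sym (geometric-factor d ⟦ x ⟧ ⟦ y ⟧)) (divides-difference x^d≈y^d)))
      where
      x^k≈y^k : ⟦ x ⟧ ^ k ≈ ⟦ y ⟧ ^ k
      x^k≈y^k = ≈-trans (≈-sym (⟦power⟧ x))
                  (≈-trans (≡⇒≈ (cong ⟦_⟧ (trans (in-fibre x∈M) (sym (in-fibre y∈M))))) (⟦power⟧ y))
      x^d≈y^d : ⟦ x ⟧ ^ d ≈ ⟦ y ⟧ ^ d
      x^d≈y^d = gcd-power k (P∤element x∈M) (P∤element y∈M) x^k≈y^k

  fibre-bound : ∀ h (M : List (Fin p)) → Unique M → (∀ {x} → x ∈ M → power x ≡ h) → length M ℕ.≤ d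
  fibre-bound h M unique in-fibre with toℕ h ℕ.≟ 0
  ... | no  h≢0 = nonzero-fibre-bound h h≢0 M unique in-fibre
  ... | yes h≡0 = ℕP.≤-trans (at-most-one-zero M unique (λ x∈M → power≡0 _ (trans (cong toℕ (in-fibre x∈M)) h≡0))) 0<d

  Q? : Decidable (Q {p} k)
  Q? b = FinP.any? (λ x → ((toℕ x ℕ.^ k) ℕ.% p) ℕ.≟ toℕ b)

  residues nonResidues : List (Fin p)
  residues    = List.filter Q? (List.allFin p)
  nonResidues = List.filter (λ b → ¬? (Q? b)) (List.allFin p)

  p≤d*|residues| : p ℕ.≤ d ℕ.* length residues
  p≤d*|residues| = subst (ℕ._≤ d ℕ.* length residues) (ListP.length-tabulate id)
    (count-by-fibres residues (List.allFin p) (Unique.allFin⁺ p)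
      (λ {x} _ → ∈-filter⁺ Q? (∈-allFin (power x)) (power-residue x)))
    where open FibreCounting FinP._≟_ power d fibre-bound

  nonResidue-count : length nonResidues ℕ.≤ ((p ℕ.∸ 1) ℕ./ d) ℕ.* (d ℕ.∸ 1)
  nonResidue-count = ℕP.+-cancelʳ-≤ (suc m) (length nonResidues) (m ℕ.* e) (begin
    length nonResidues ℕ.+ suc m                ≤⟨ ℕP.+-monoʳ-≤ (length nonResidues) m<|residues| ⟩
    length nonResidues ℕ.+ length residues      ≡⟨ ℕP.+-comm (length nonResidues) _ ⟩
    length residues ℕ.+ length nonResidues      ≡⟨ |residues|+|nonResidues| ⟩
    p                                           ≡⟨ p≡1+m*d ⟩
    suc (m ℕ.* d)                               ≡⟨ cong (λ t → suc (m ℕ.* t)) d≡1+e ⟩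
    suc (m ℕ.* suc e)                           ≡⟨ cong suc (trans (ℕP.*-suc m e) (ℕP.+-comm m (m ℕ.* e))) ⟩
    suc (m ℕ.* e ℕ.+ m)                         ≡⟨ ℕP.+-suc (m ℕ.* e) m ⟨
    m ℕ.* e ℕ.+ suc m                           ∎)
    where
    open ℕP.≤-Reasoning
    m e : ℕ
    m = (p ℕ.∸ 1) ℕ./ d
    e = d ℕ.∸ 1
    d≡1+e : d ≡ suc e
    d≡1+e = sym (ℕP.suc-pred d)
    p≡1+m*d : p ≡ suc (m ℕ.* d)
    p≡1+m*d = trans (sym (ℕP.suc-pred p)) (cong suc (sym (ℕDM.m/n*n≡m (gcd[m,n]∣n k (p ℕ.∸ 1)))))
    |residues|+|nonResidues| : length residues ℕ.+ length nonResidues ≡ p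
    |residues|+|nonResidues| = trans (length-filter-split Q? (List.allFin p))
                                     (ListP.length-tabulate id)
    m<|residues| : m ℕ.< length residues
    m<|residues| = ℕP.*-cancelˡ-< d m (length residues) (begin-strict
      d ℕ.* m          ≡⟨ ℕP.*-comm d m ⟩
      m ℕ.* d          <⟨ ℕP.n<1+n (m ℕ.* d) ⟩
      suc (m ℕ.* d)    ≡⟨ p≡1+m*d ⟨
      p                ≤⟨ p≤d*|residues| ⟩
      d ℕ.* length residues ∎)

module ResidueDifferences (p : ℕ) (p-prime : Prime p) (k : ℕ) (0<k : 0 ℕ.< k) where

  open ℤ using (ℤ; _-_; -_)
  open Kernels
  open ModPrime p p-prime
  open RankBound p p-prime
  open PowerResidues p p-prime k 0<k
  open import Data.Integer.Divisibility.Signed using (_∣_; ∣m⇒∣-m; ∣n⇒∣m*n; ∣m⇒∣m*n)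

  shiftedProduct-root : ∀ {cs c} x y → c ∈ cs → P ∣ x - y - c → P ∣ shiftedProduct cs x y
  shiftedProduct-root {c′ ∷ cs} x y (here refl) P∣x-y-c = ∣m⇒∣m*n (shiftedProduct cs x y) P∣x-y-c
  shiftedProduct-root {c′ ∷ cs} x y (there c∈cs) P∣x-y-c =
    ∣n⇒∣m*n (x - y - c′) (shiftedProduct-root x y c∈cs P∣x-y-c)

  shiftedProduct-diagonal : ∀ cs x → (∀ {c} → c ∈ cs → ¬ P ∣ c) → ¬ P ∣ shiftedProduct cs x x
  shiftedProduct-diagonal []       x _         = P∤1
  shiftedProduct-diagonal (c ∷ cs) x P∤cs =
    P∤* (λ P∣x-x-c → P∤cs (here refl) (subst (P ∣_) (negate x c) (∣m⇒∣-m P∣x-x-c)))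
        (shiftedProduct-diagonal cs x (λ c∈cs → P∤cs (there c∈cs)))
    where
    negate : ∀ x c → - (x - x - c) ≡ c
    negate = solve-∀

  -- 0 is a k-th power residue, so non-residues are not ≡ 0.
  P∤nonResidue : ∀ {c} → c ∈ List.map ⟦_⟧ nonResidues → ¬ P ∣ c
  P∤nonResidue c∈ with ∈-map⁻ ⟦_⟧ c∈
  ... | b , b∈ , refl = P∤residue b≢0 (FinP.toℕ<n b)
    where
    b≢0 : toℕ b ≢ 0
    b≢0 b≡0 = proj₂ (∈-filter⁻ (λ b → ¬? (Q? b)) {xs = List.allFin p} b∈)
      (b , trans (cong (λ t → (t ℕ.^ k) ℕ.% p) b≡0) (trans 0^k%p≡0 (sym b≡0)))

  G : Fin p → Fin p → ℤ
  G a b = shiftedProduct (List.map ⟦_⟧ nonResidues) ⟦ a ⟧ ⟦ b ⟧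

  lowRank-G : LowRank G (suc (length nonResidues))
  lowRank-G = subst (LowRank G) (cong suc (ListP.length-map ⟦_⟧ nonResidues))
                    (lowRank-pullback ⟦_⟧ (lowRank-shiftedProduct (List.map ⟦_⟧ nonResidues)))

  G-off-diagonal : ∀ a b → ¬ Q {p} k (a -ₚ b) → P ∣ G a b
  G-off-diagonal a b a-b∉Q =
    shiftedProduct-root ⟦ a ⟧ ⟦ b ⟧
      (∈-map⁺ ⟦_⟧ (∈-filter⁺ (λ b → ¬? (Q? b)) (∈-allFin (a -ₚ b)) a-b∉Q))
      (divides-difference (≈-sym (⟦-ₚ⟧ a b)))

  Gⁿ-diagonal : ∀ {n} (a : Vec (Fin p) n) → ¬ P ∣ productKernel G a a
  Gⁿ-diagonal []      = P∤1
  Gⁿ-diagonal (x ∷ a) = P∤* (shiftedProduct-diagonal _ ⟦ x ⟧ P∤nonResidue) (Gⁿ-diagonal a)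

  Gⁿ-off-diagonal : ∀ {n} (a b : Vec (Fin p) n) → ¬ Qⁿ {p} k (a -ᵥ b) → P ∣ productKernel G a b
  Gⁿ-off-diagonal []      []      a-b∉Qⁿ = ⊥-elim (a-b∉Qⁿ VecAll.[])
  Gⁿ-off-diagonal (x ∷ a) (y ∷ b) a-b∉Qⁿ with Q? (x -ₚ y)
  ... | yes x-y∈Q = ∣n⇒∣m*n (G x y) (Gⁿ-off-diagonal a b (λ a-b∈Qⁿ → a-b∉Qⁿ (x-y∈Q VecAll.∷ a-b∈Qⁿ)))
  ... | no  x-y∉Q = ∣m⇒∣m*n (productKernel G a b) (G-off-diagonal x y x-y∉Q)

  residue-free-bound : ∀ n (A : List (Vec (Fin p) n)) → Unique A →
    (∀ a₁ a₂ → a₁ ∈ A → a₂ ∈ A → ¬ (a₁ ≢ a₂ × Qⁿ {p} k (a₁ -ᵥ a₂))) →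
    length A ℕ.≤ suc (length nonResidues) ℕ.^ n
  residue-free-bound n A unique residue-free =
    rank-bound (lowRank-productKernel lowRank-G n) A unique
      (λ {a} _ → Gⁿ-diagonal a)
      (λ {a₁} {a₂} a₁∈A a₂∈A a₁≢a₂ → Gⁿ-off-diagonal a₁ a₂ (λ a₁-a₂∈Qⁿ → residue-free a₁ a₂ a₁∈A a₂∈A (a₁≢a₂ , a₁-a₂∈Qⁿ)))

open import Data.Nat using (_+_; _*_; _∸_; _^_; _≥_; _<_)
open import Data.Nat.DivMod using (_/_)

-- Either two distinct members of A differ by an element of (Q(k))^n, or A is
-- residue-difference-free and the polynomial-method bound applies; the bound
-- (|F_p \ Q(k)| + 1)^n ≤ ((p − 1)/d · (d − 1) + 1)^n contradicts the size of A.
corollary1p3 : (p k n : ℕ) → Prime p → p ≥ 3 → k ≥ 2 → n ≥ 1 →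
    .{{_ : NonZero p}} → .{{_ : NonZero (gcd k (p ∸ 1))}} →
    (A : List (Vec (Fin p) n)) → Unique A →
    (((p ∸ 1) / gcd k (p ∸ 1)) * (gcd k (p ∸ 1) ∸ 1) + 1) ^ n < length A →
    Σ (Vec (Fin p) n) λ a₁ → Σ (Vec (Fin p) n) λ a₂ →
    a₁ ∈ A × a₂ ∈ A × ¬ (a₁ ≡ a₂) × Qⁿ k (a₁ -ᵥ a₂)
corollary1p3 p k n p-prime _ k≥2 _ A unique |A|>bound =
  [ id , (λ residue-free → ⊥-elim (ℕP.<⇒≱ |A|>bound (size-bound residue-free))) ]′ (related-pair? good? A)
  where
  0<k : 0 < k
  0<k = ℕP.≤-trans (ℕ.s≤s ℕ.z≤n) k≥2
  open PowerResidues p p-prime k 0<k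
  open ResidueDifferences p p-prime k 0<k
  open ℕP.≤-Reasoning
  good? : ∀ a₁ a₂ → Dec (¬ (a₁ ≡ a₂) × Qⁿ {p} k (a₁ -ᵥ a₂))
  good? a₁ a₂ = ¬? (VecP.≡-dec FinP._≟_ a₁ a₂) ×-dec VecAll.all? Q? (a₁ -ᵥ a₂)
  size-bound : (∀ a₁ a₂ → a₁ ∈ A → a₂ ∈ A → ¬ (¬ (a₁ ≡ a₂) × Qⁿ {p} k (a₁ -ᵥ a₂))) →
    length A ℕ.≤ ((p ∸ 1) / d * (d ∸ 1) + 1) ^ n
  size-bound residue-free = begin
    length A                           ≤⟨ residue-free-bound n A unique residue-free ⟩
    suc (length nonResidues) ^ n       ≤⟨ ℕP.^-monoˡ-≤ n (ℕ.s≤s nonResidue-count) ⟩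
    suc ((p ∸ 1) / d * (d ∸ 1)) ^ n    ≡⟨ cong (_^ n) (ℕP.+-comm 1 _) ⟩
    ((p ∸ 1) / d * (d ∸ 1) + 1) ^ n    ∎
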